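{- Let $H$ be a connected simple graph with maximum degree exactly $3$ and with $n_H(C_3)\geq 4$ triangles. Then either $H\cong K_4$, or the number of vertices of $H$ of degree $3$ is at least $n_H(C_3)+2$. -}

module Defs where

open import Data.Nat using (ℕ; _+_; _≤_; _<_)
open import Data.Bool using (Bool; true; false; not; _∧_; if_then_else_)
open import Data.Fin using (Fin)
open import Data.Fin.Properties using () renaming (_≟_ to _≟ᶠ_)
open import Data.List using (List; allFin; map; filter; length)
open import Data.Nat.ListAction using (sum)
open import Data.Product using (Σ; ∃; _×_; _,_)
open import Relation.Nullary using (¬_; does)
open import Relation.Binary.PropositionalEquality using (_≡_)
open import Relation.Binary.Construct.Closure.ReflexiveTransitive using (Star)
open import Function.Bundles using (Bijection; _⤖_)

record Graph (n : ℕ) : Set where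
  field
    adj    : Fin n → Fin n → Bool
    adj-sym    : ∀ u v → adj u v ≡ adj v u
    adj-irrefl : ∀ v → adj v v ≡ false
open Graph public

Adj : ∀ {n} → Graph n → Fin n → Fin n → Set
Adj G u v = adj G u v ≡ true

degree : ∀ {n} → Graph n → Fin n → ℕ
degree {n} G v = length (filter (λ u → adj G v u ≡? true) (allFin n))
  where
  _≡?_ : (a b : Bool) → _
  _≡?_ = Data.Bool._≟_
  open import Data.Bool using (_≟_)

Connected : ∀ {n} → Graph n → Set
Connected {n} G = ∀ (u v : Fin n) → Star (Adj G) u v

MaxDegree : ∀ {n} → Graph n → ℕ → Set
MaxDegree {n} G d = (∀ v → degree G v ≤ d) × (∃ λ v → degree G v ≡ d)

numDeg : ∀ {n} → Graph n → ℕ → ℕ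
numDeg {n} G d = length (filter (λ v → degree G v Data.Nat.≟ d) (allFin n))
  where import Data.Nat

triangles : ∀ {n} → Graph n → ℕ
triangles {n} G =
  sum (map (λ i → sum (map (λ j → sum (map (λ k →
    cnt i j k) (allFin n))) (allFin n))) (allFin n))
  where
  open import Data.Fin using (_<?_)
  cnt : Fin n → Fin n → Fin n → ℕ
  cnt i j k = if does (i <? j) ∧ does (j <? k) ∧ adj G i j ∧ adj G j k ∧ adj G i k
              then 1 else 0

complete : (m : ℕ) → Graph m
complete m = record
  { adj = λ u v → not (does (u ≟ᶠ v))
  ; adj-sym = λ u v → symm u v
  ; adj-irrefl = λ v → irr v }
  where
  open import Relation.Nullary using (yes; no)
  open import Relation.Binary.PropositionalEquality using (refl; sym)
  symm : ∀ (u v : Fin m) → not (does (u ≟ᶠ v)) ≡ not (does (v ≟ᶠ u))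
  symm u v with u ≟ᶠ v | v ≟ᶠ u
  ... | yes _ | yes _ = refl
  ... | no _  | no _  = refl
  ... | yes p | no q  = Data.Empty.⊥-elim (q (sym p)) where import Data.Empty
  ... | no p  | yes q = Data.Empty.⊥-elim (p (sym q)) where import Data.Empty
  irr : ∀ (v : Fin m) → not (does (v ≟ᶠ v)) ≡ false
  irr v with v ≟ᶠ v
  ... | yes _ = refl
  ... | no p  = Data.Empty.⊥-elim (p refl) where import Data.Empty

_≅_ : ∀ {n m} → Graph n → Graph m → Set
_≅_ {n} {m} G H = Σ (Fin n ⤖ Fin m) λ f →
  ∀ u v → adj G u v ≡ adj H (Bijection.to f u) (Bijection.to f v)

{-# OPTIONS --safe #-}
-- Rank the vertices breadth-first from a root r, so that every vertex except r has an earlier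
-- neighbour. Counting each triangle at its last vertex k, the triangles at k are the edges
-- among the earlier neighbours of k; as there are at most three of them, they span fewer
-- edges than their number b ≥ 1 unless they form a triangle, and then k lies in a K₄, which
-- in a connected graph of maximum degree 3 is the whole graph. Otherwise summing over k gives
-- t + (n − 1) ≤ e, while 2e = Σ deg ≤ 2n + n₃; hence 2t ≤ n₃ + 2, i.e. t + 2 ≤ n₃ once t ≥ 4.
module Submission where

open import Defs
open import Data.Bool using (Bool; true; false; not; _∧_; _∨_; if_then_else_; T)
open import Data.Bool.Properties using (∧-comm; ∧-assoc; T-≡; T-∧; T-∨) renaming (_≟_ to _≟ᴮ_)
open import Data.Empty using (⊥-elim)
open import Data.Fin using (Fin; zero; suc; toℕ; _≟_)
open import Data.Fin.Patterns using (0F; 1F; 2F; 3F)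
open import Data.Fin.Properties using (any?; toℕ-injective; toℕ<n; injective⇒≤)
open import Data.List using (List; []; _∷_; length; map; filter; filterᵇ; tabulate; allFin)
open import Data.List.Membership.Propositional using (_∈_)
open import Data.List.Membership.Propositional.Properties using (∈-filter⁺; ∈-allFin)
open import Data.List.Membership.Setoid.Properties using (index-injective)
open import Data.List.Relation.Unary.All as All using (All; []; _∷_)
open import Data.List.Relation.Unary.All.Properties using (all-filter)
open import Data.List.Relation.Unary.Any using (index)
open import Data.Nat using (ℕ; zero; suc; _+_; _*_; _≤_; _<_; _<ᵇ_; z≤n; s≤s; _<?_)
import Data.Nat as ℕ
import Data.Nat.ListAction as ListAction
open import Data.Nat.Properties hiding (_≟_)
open import Algebra.Properties.Semiring.Sum +-*-semiring
  using (sum-syntax; sum-cong-≗; ∑-distrib-+; ∑-comm; *-distribˡ-sum)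
open import Data.Nat.Tactic.RingSolver using (solve-∀)
open import Data.Product using (Σ; ∃; _×_; _,_; proj₁; proj₂)
open import Data.Sum using (_⊎_; inj₁; inj₂; [_,_]′; reduce)
open import Function using (_∘_; id)
open import Function.Bundles using (Equivalence; mk⤖)
open import Function.Definitions using (Injective)
open import Relation.Binary using (tri<; tri≈; tri>)
open import Relation.Binary.Construct.Closure.ReflexiveTransitive using (Star; ε; _◅_)
open import Relation.Binary.PropositionalEquality
open import Relation.Nullary using (¬_; does; yes; no; contradiction)
open import Relation.Nullary.Decidable using (dec-true; dec-false; isYes; T?; toWitness; fromWitness)
open import Relation.Unary using (Pred; Decidable)

⟦_⟧ : Bool → ℕ
⟦ b ⟧ = if b then 1 else 0

⟦⟧≤1 : ∀ b → ⟦ b ⟧ ≤ 1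
⟦⟧≤1 false = z≤n
⟦⟧≤1 true  = s≤s z≤n

⟦∧⟧≤⟦⟧ˡ : ∀ a b → ⟦ a ∧ b ⟧ ≤ ⟦ a ⟧
⟦∧⟧≤⟦⟧ˡ false b = z≤n
⟦∧⟧≤⟦⟧ˡ true  b = ⟦⟧≤1 b

⟦⟧+⟦not⟧ : ∀ b → ⟦ b ⟧ + ⟦ not b ⟧ ≡ 1
⟦⟧+⟦not⟧ false = refl
⟦⟧+⟦not⟧ true  = refl

T-∧⁻ : ∀ a b → T (a ∧ b) → T a × T b
T-∧⁻ true b t = _ , t

⟦∧∧⟧≤⟦⟧₂ : ∀ a b c → ⟦ a ∧ b ∧ c ⟧ ≤ ⟦ b ⟧
⟦∧∧⟧≤⟦⟧₂ false b c = z≤n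
⟦∧∧⟧≤⟦⟧₂ true  b c = ⟦∧⟧≤⟦⟧ˡ b c

⟦⟧-supported : ∀ b p q → (T b → T p × T q) → ⟦ b ⟧ ≡ ⟦ p ⟧ * (⟦ q ⟧ * ⟦ b ⟧)
⟦⟧-supported false p     q     _ = sym (trans (cong (⟦ p ⟧ *_) (*-zeroʳ ⟦ q ⟧)) (*-zeroʳ ⟦ p ⟧))
⟦⟧-supported true  true  true  _ = refl
⟦⟧-supported true  false q     h = ⊥-elim (proj₁ (h _))
⟦⟧-supported true  true  false h = ⊥-elim (proj₂ (h _))

⟦⟧-sum₃ : ∀ p q r → ⟦ p ⟧ + ⟦ q ⟧ + ⟦ r ⟧ < 3 ⊎ T p × T q × T r
⟦⟧-sum₃ false q     r     = inj₁ (s≤s (+-mono-≤ (⟦⟧≤1 q) (⟦⟧≤1 r)))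
⟦⟧-sum₃ true  false r     = inj₁ (s≤s (s≤s (⟦⟧≤1 r)))
⟦⟧-sum₃ true  true  false = inj₁ (s≤s (s≤s (s≤s z≤n)))
⟦⟧-sum₃ true  true  true  = inj₂ _

∑-mono-≤ : ∀ {n} {f g : Fin n → ℕ} → (∀ i → f i ≤ g i) → ∑[ i < n ] f i ≤ ∑[ i < n ] g i
∑-mono-≤ {zero}  f≤g = z≤n
∑-mono-≤ {suc n} f≤g = +-mono-≤ (f≤g zero) (∑-mono-≤ (f≤g ∘ suc))

∑-const : ∀ n c → ∑[ i < n ] c ≡ n * c
∑-const zero    c = refl
∑-const (suc n) c = cong (c +_) (∑-const n c)

term≤∑ : ∀ {n} (f : Fin n → ℕ) i → f i ≤ ∑[ j < n ] f j
term≤∑ f zero    = m≤m+n (f zero) _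
term≤∑ f (suc i) = ≤-trans (term≤∑ (f ∘ suc) i) (m≤n+m _ (f zero))

∑-indicator : ∀ {n} (r : Fin n) → ∑[ k < n ] ⟦ does (k ≟ r) ⟧ ≡ 1
∑-indicator {suc n} zero    = cong suc (trans (∑-const n 0) (*-zeroʳ n))
∑-indicator {suc n} (suc r) = ∑-indicator r

module _ {a p} {A : Set a} {P : Pred A p} (P? : Decidable P) where

  length-filter-tabulate : ∀ {n} (f : Fin n → A) →
    length (filter P? (tabulate f)) ≡ ∑[ i < n ] ⟦ does (P? (f i)) ⟧
  length-filter-tabulate {zero}  f = refl
  length-filter-tabulate {suc n} f with does (P? (f zero))
  ... | true  = cong suc (length-filter-tabulate (f ∘ suc))
  ... | false = length-filter-tabulate (f ∘ suc)

  sum-map-filter-tabulate : ∀ {n} (g : A → ℕ) (f : Fin n → A) →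
    ListAction.sum (map g (filter P? (tabulate f))) ≡ ∑[ i < n ] (⟦ does (P? (f i)) ⟧ * g (f i))
  sum-map-filter-tabulate {zero}  g f = refl
  sum-map-filter-tabulate {suc n} g f with does (P? (f zero))
  ... | true  = cong₂ _+_ (sym (*-identityˡ _)) (sum-map-filter-tabulate g (f ∘ suc))
  ... | false = sum-map-filter-tabulate g (f ∘ suc)

sum-map-tabulate : ∀ {a} {A : Set a} {n} (g : A → ℕ) (f : Fin n → A) →
  ListAction.sum (map g (tabulate f)) ≡ ∑[ i < n ] g (f i)
sum-map-tabulate {n = zero}  g f = refl
sum-map-tabulate {n = suc n} g f = cong (g (f zero) +_) (sum-map-tabulate g (f ∘ suc))

∀-or : ∀ {n b} {A : Fin n → Set} {B : Set b} → (∀ i → A i ⊎ B) → (∀ i → A i) ⊎ B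
∀-or {zero}  f = inj₁ λ ()
∀-or {suc n} f with f zero | ∀-or (f ∘ suc)
... | inj₂ b | _      = inj₂ b
... | inj₁ _ | inj₂ b = inj₂ b
... | inj₁ a | inj₁ g = inj₁ λ { zero → a ; (suc i) → g i }

<ᵇ-true : ∀ {x y} → x < y → (x <ᵇ y) ≡ true
<ᵇ-true {x} {y} = dec-true (x <? y)

<ᵇ-false : ∀ {x y} → ¬ x < y → (x <ᵇ y) ≡ false
<ᵇ-false {x} {y} = dec-false (x <? y)

<ᵇ-flip : ∀ {x y} → x ≢ y → (y <ᵇ x) ≡ not (x <ᵇ y)
<ᵇ-flip {x} {y} x≢y with <-cmp x y
... | tri< x<y _ _ rewrite <ᵇ-true x<y | <ᵇ-false (<-asym x<y) = refl
... | tri≈ _ x≡y _ = contradiction x≡y x≢y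
... | tri> _ _ y<x rewrite <ᵇ-true y<x | <ᵇ-false (<-asym y<x) = refl

⟦<ᵇ⟧-asym : ∀ x y → ⟦ x <ᵇ y ⟧ + ⟦ y <ᵇ x ⟧ ≤ 1
⟦<ᵇ⟧-asym x y with <-cmp x y
... | tri< x<y _ _ rewrite <ᵇ-true x<y | <ᵇ-false (<-asym x<y) = ≤-refl
... | tri≈ _ refl _ rewrite <ᵇ-false (<-irrefl {x} refl) = z≤n
... | tri> _ _ y<x rewrite <ᵇ-true y<x | <ᵇ-false (<-asym y<x) = ≤-refl

exactly-one-of-six : ∀ a b c → (T a → T b → T c) → (T c → T a ⊎ T b) →
  1 ≡ ⟦ a ∧ b ⟧ + ⟦ c ∧ not b ⟧ + ⟦ not a ∧ c ⟧ + ⟦ b ∧ not c ⟧ + ⟦ not c ∧ a ⟧ + ⟦ not b ∧ not a ⟧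
exactly-one-of-six true  true  true  _  _  = refl
exactly-one-of-six true  true  false ab _  = ⊥-elim (ab _ _)
exactly-one-of-six true  false true  _  _  = refl
exactly-one-of-six true  false false _  _  = refl
exactly-one-of-six false true  true  _  _  = refl
exactly-one-of-six false true  false _  _  = refl
exactly-one-of-six false false true  _  c  = ⊥-elim (reduce (c _))
exactly-one-of-six false false false _  _  = refl

one-of-six-orderings : ∀ {x y z} → x ≢ y → y ≢ z → x ≢ z →
  1 ≡ ⟦ (x <ᵇ y) ∧ (y <ᵇ z) ⟧ + ⟦ (x <ᵇ z) ∧ (z <ᵇ y) ⟧ + ⟦ (y <ᵇ x) ∧ (x <ᵇ z) ⟧
    + ⟦ (y <ᵇ z) ∧ (z <ᵇ x) ⟧ + ⟦ (z <ᵇ x) ∧ (x <ᵇ y) ⟧ + ⟦ (z <ᵇ y) ∧ (y <ᵇ x) ⟧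
one-of-six-orderings {x} {y} {z} x≢y y≢z x≢z
  rewrite <ᵇ-flip x≢y | <ᵇ-flip y≢z | <ᵇ-flip x≢z =
  exactly-one-of-six (x <ᵇ y) (y <ᵇ z) (x <ᵇ z) transitive split
  where
  transitive : T (x <ᵇ y) → T (y <ᵇ z) → T (x <ᵇ z)
  transitive p q = <⇒<ᵇ (<-trans (<ᵇ⇒< x y p) (<ᵇ⇒< y z q))
  split : T (x <ᵇ z) → T (x <ᵇ y) ⊎ T (y <ᵇ z)
  split p with x <? y
  ... | yes x<y = inj₁ (<⇒<ᵇ x<y)
  ... | no  x≮y = inj₂ (<⇒<ᵇ (≤-<-trans (≮⇒≥ x≮y) (<ᵇ⇒< x z p)))

∑³ : ∀ {n} → (Fin n → Fin n → Fin n → ℕ) → ℕ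
∑³ {n} f = ∑[ i < n ] ∑[ j < n ] ∑[ k < n ] f i j k

module _ {n : ℕ} where

  ∑³-cong : {f g : Fin n → Fin n → Fin n → ℕ} → (∀ i j k → f i j k ≡ g i j k) → ∑³ f ≡ ∑³ g
  ∑³-cong f≡g = sum-cong-≗ λ i → sum-cong-≗ λ j → sum-cong-≗ (f≡g i j)

  ∑³-distrib-+ : (f g : Fin n → Fin n → Fin n → ℕ) →
    ∑³ (λ i j k → f i j k + g i j k) ≡ ∑³ f + ∑³ g
  ∑³-distrib-+ f g = begin
    ∑³ (λ i j k → f i j k + g i j k)
      ≡⟨ sum-cong-≗ (λ i → sum-cong-≗ λ j → ∑-distrib-+ (f i j) (g i j)) ⟩
    ∑[ i < n ] ∑[ j < n ] (∑[ k < n ] f i j k + ∑[ k < n ] g i j k)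
      ≡⟨ sum-cong-≗ (λ i → ∑-distrib-+ (λ j → ∑[ k < n ] f i j k) (λ j → ∑[ k < n ] g i j k)) ⟩
    ∑[ i < n ] (∑[ j < n ] ∑[ k < n ] f i j k + ∑[ j < n ] ∑[ k < n ] g i j k)
      ≡⟨ ∑-distrib-+ (λ i → ∑[ j < n ] ∑[ k < n ] f i j k) (λ i → ∑[ j < n ] ∑[ k < n ] g i j k) ⟩
    ∑³ f + ∑³ g ∎
    where open ≡-Reasoning

  ∑³-swap₂₃ : (f : Fin n → Fin n → Fin n → ℕ) → ∑³ (λ i j k → f i k j) ≡ ∑³ f
  ∑³-swap₂₃ f = sum-cong-≗ λ i → ∑-comm (λ j k → f i k j)

  ∑³-swap₁₂ : (f : Fin n → Fin n → Fin n → ℕ) → ∑³ (λ i j k → f j i k) ≡ ∑³ f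
  ∑³-swap₁₂ f = ∑-comm (λ i j → ∑[ k < n ] f j i k)

  ∑³-rotate : (f : Fin n → Fin n → Fin n → ℕ) → ∑³ (λ i j k → f j k i) ≡ ∑³ f
  ∑³-rotate f = trans (∑³-swap₁₂ (λ i j k → f i k j)) (∑³-swap₂₃ f)

  symmetrise : (Fin n → Fin n → Fin n → ℕ) → Fin n → Fin n → Fin n → ℕ
  symmetrise f i j k = f i j k + f i k j + f j i k + f j k i + f k i j + f k j i

  ∑³-symmetrise : (f : Fin n → Fin n → Fin n → ℕ) → ∑³ (symmetrise f) ≡ 6 * ∑³ f
  ∑³-symmetrise f = begin
    ∑³ (symmetrise f)
      ≡⟨ ∑³-distrib-+ _ f₃₂₁ ⟩
    ∑³ (λ i j k → f i j k + f₁₃₂ i j k + f₂₁₃ i j k + f₂₃₁ i j k + f₃₁₂ i j k) + ∑³ f₃₂₁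
      ≡⟨ cong (_+ ∑³ f₃₂₁) (∑³-distrib-+ _ f₃₁₂) ⟩
    ∑³ (λ i j k → f i j k + f₁₃₂ i j k + f₂₁₃ i j k + f₂₃₁ i j k) + ∑³ f₃₁₂ + ∑³ f₃₂₁
      ≡⟨ cong (λ s → s + ∑³ f₃₁₂ + ∑³ f₃₂₁) (∑³-distrib-+ _ f₂₃₁) ⟩
    ∑³ (λ i j k → f i j k + f₁₃₂ i j k + f₂₁₃ i j k) + ∑³ f₂₃₁ + ∑³ f₃₁₂ + ∑³ f₃₂₁
      ≡⟨ cong (λ s → s + ∑³ f₂₃₁ + ∑³ f₃₁₂ + ∑³ f₃₂₁) (∑³-distrib-+ _ f₂₁₃) ⟩
    ∑³ (λ i j k → f i j k + f₁₃₂ i j k) + ∑³ f₂₁₃ + ∑³ f₂₃₁ + ∑³ f₃₁₂ + ∑³ f₃₂₁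
      ≡⟨ cong (λ s → s + ∑³ f₂₁₃ + ∑³ f₂₃₁ + ∑³ f₃₁₂ + ∑³ f₃₂₁) (∑³-distrib-+ f f₁₃₂) ⟩
    ∑³ f + ∑³ f₁₃₂ + ∑³ f₂₁₃ + ∑³ f₂₃₁ + ∑³ f₃₁₂ + ∑³ f₃₂₁
      ≡⟨ cong₂ _+_ (cong₂ _+_ (cong₂ _+_ (cong₂ _+_ (cong (∑³ f +_) (∑³-swap₂₃ f))
           (∑³-swap₁₂ f)) (∑³-rotate f)) ∑f₃₁₂) ∑f₃₂₁ ⟩
    ∑³ f + ∑³ f + ∑³ f + ∑³ f + ∑³ f + ∑³ f
      ≡⟨ six-times (∑³ f) ⟩
    6 * ∑³ f ∎
    where
    open ≡-Reasoning
    f₁₃₂ f₂₁₃ f₂₃₁ f₃₁₂ f₃₂₁ : Fin n → Fin n → Fin n → ℕ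
    f₁₃₂ i j k = f i k j
    f₂₁₃ i j k = f j i k
    f₂₃₁ i j k = f j k i
    f₃₁₂ i j k = f k i j
    f₃₂₁ i j k = f k j i
    ∑f₃₁₂ : ∑³ f₃₁₂ ≡ ∑³ f
    ∑f₃₁₂ = trans (∑³-swap₂₃ f₂₁₃) (∑³-swap₁₂ f)
    ∑f₃₂₁ : ∑³ f₃₂₁ ≡ ∑³ f
    ∑f₃₂₁ = trans (∑³-swap₁₂ f₃₁₂) ∑f₃₁₂
    six-times : ∀ x → x + x + x + x + x + x ≡ 6 * x
    six-times = solve-∀

sortedCount : ∀ {n} → (Fin n → Fin n → Fin n → Bool) → (Fin n → ℕ) → ℕ
sortedCount t ρ = ∑³ λ i j k → ⟦ t i j k ∧ (ρ i <ᵇ ρ j) ∧ (ρ j <ᵇ ρ k) ⟧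

module _ {n : ℕ} {t : Fin n → Fin n → Fin n → Bool}
         (t-swap₂₃ : ∀ i j k → t i k j ≡ t i j k)
         (t-swap₁₂ : ∀ i j k → t j i k ≡ t i j k)
         (t-distinct : ∀ {i j k} → T (t i j k) → i ≢ j) where

  private
    t-rotate : ∀ i j k → t j k i ≡ t i j k
    t-rotate i j k = trans (t-swap₂₃ j i k) (t-swap₁₂ i j k)

    t-rotate² : ∀ i j k → t k i j ≡ t i j k
    t-rotate² i j k = trans (t-swap₁₂ i k j) (t-swap₂₃ i j k)

    t-reverse : ∀ i j k → t k j i ≡ t i j k
    t-reverse i j k = trans (t-swap₂₃ k i j) (t-rotate² i j k)

  ⟦t⟧≡symmetrise-sorted : ∀ {ρ} → Injective _≡_ _≡_ ρ → ∀ i j k →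
    ⟦ t i j k ⟧ ≡ symmetrise (λ a b c → ⟦ t a b c ∧ (ρ a <ᵇ ρ b) ∧ (ρ b <ᵇ ρ c) ⟧) i j k
  ⟦t⟧≡symmetrise-sorted {ρ} ρ-inj i j k
    rewrite t-swap₂₃ i j k | t-swap₁₂ i j k | t-rotate i j k | t-rotate² i j k | t-reverse i j k
    with t i j k in tijk
  ... | false = refl
  ... | true  = one-of-six-orderings (distinct tijk) (distinct (trans (t-rotate i j k) tijk))
                  (distinct (trans (t-swap₂₃ i j k) tijk))
    where
    distinct : ∀ {a b c} → t a b c ≡ true → ρ a ≢ ρ b
    distinct tabc = t-distinct (subst T (sym tabc) _) ∘ ρ-inj

  -- Both counts are a sixth of the number of ordered triples: exactly one of the six orderings
  -- of a triangle is sorted by an injective ranking.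
  sortedCount-ranking-invariant : ∀ {ρ ρ′} → Injective _≡_ _≡_ ρ → Injective _≡_ _≡_ ρ′ →
    sortedCount t ρ ≡ sortedCount t ρ′
  sortedCount-ranking-invariant ρ-inj ρ′-inj =
    *-cancelˡ-≡ _ _ 6 (trans (sym (six-sorted ρ-inj)) (six-sorted ρ′-inj))
    where
    six-sorted : ∀ {ρ} → Injective _≡_ _≡_ ρ → ∑³ (λ i j k → ⟦ t i j k ⟧) ≡ 6 * sortedCount t ρ
    six-sorted {ρ} ρ-inj = trans (∑³-cong (⟦t⟧≡symmetrise-sorted ρ-inj))
      (∑³-symmetrise λ i j k → ⟦ t i j k ∧ (ρ i <ᵇ ρ j) ∧ (ρ j <ᵇ ρ k) ⟧)

module _ {n : ℕ} (G : Graph n) where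

  Adj-sym : ∀ {u v} → Adj G u v → Adj G v u
  Adj-sym {u} {v} uv = trans (adj-sym G v u) uv

  Adj⇒≢ : ∀ {u v} → Adj G u v → u ≢ v
  Adj⇒≢ {u} uv refl with trans (sym uv) (adj-irrefl G u)
  ... | ()

  isTriangle : Fin n → Fin n → Fin n → Bool
  isTriangle i j k = adj G i j ∧ adj G j k ∧ adj G i k

  isTriangle-swap₂₃ : ∀ i j k → isTriangle i k j ≡ isTriangle i j k
  isTriangle-swap₂₃ i j k rewrite adj-sym G k j = begin
    adj G i k ∧ adj G j k ∧ adj G i j    ≡⟨ ∧-assoc (adj G i k) _ _ ⟨
    (adj G i k ∧ adj G j k) ∧ adj G i j  ≡⟨ ∧-comm _ (adj G i j) ⟩
    adj G i j ∧ adj G i k ∧ adj G j k    ≡⟨ cong (adj G i j ∧_) (∧-comm (adj G i k) _) ⟩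
    adj G i j ∧ adj G j k ∧ adj G i k    ∎
    where open ≡-Reasoning

  isTriangle-swap₁₂ : ∀ i j k → isTriangle j i k ≡ isTriangle i j k
  isTriangle-swap₁₂ i j k rewrite adj-sym G j i = cong (adj G i j ∧_) (∧-comm (adj G i k) _)

  isTriangle⇒≢ : ∀ {i j k} → T (isTriangle i j k) → i ≢ j
  isTriangle⇒≢ t = Adj⇒≢ (Equivalence.to T-≡ (proj₁ (Equivalence.to T-∧ t)))

  triangles≡sortedCount : triangles G ≡ sortedCount isTriangle toℕ
  triangles≡sortedCount = begin
    triangles G
      ≡⟨ trans (sum-map-tabulate (λ i → ∑ˡ λ j → ∑ˡ (cnt i j)) id) (sum-cong-≗ λ i →
           trans (sum-map-tabulate (λ j → ∑ˡ (cnt i j)) id) (sum-cong-≗ λ j →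
             sum-map-tabulate (cnt i j) id)) ⟩
    ∑³ cnt
      ≡⟨ ∑³-cong (λ i j k → cong ⟦_⟧ (∧-rotate (toℕ i <ᵇ toℕ j) (toℕ j <ᵇ toℕ k) (isTriangle i j k))) ⟩
    sortedCount isTriangle toℕ ∎
    where
    open ≡-Reasoning
    cnt : Fin n → Fin n → Fin n → ℕ
    cnt i j k = ⟦ (toℕ i <ᵇ toℕ j) ∧ (toℕ j <ᵇ toℕ k) ∧ isTriangle i j k ⟧
    ∑ˡ : (Fin n → ℕ) → ℕ
    ∑ˡ f = ListAction.sum (map f (allFin n))
    ∧-rotate : ∀ a b c → a ∧ b ∧ c ≡ c ∧ a ∧ b
    ∧-rotate a b c = trans (sym (∧-assoc a b c)) (∧-comm (a ∧ b) c)

  neighbours : Fin n → List (Fin n)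
  neighbours v = filter (λ u → adj G v u ≟ᴮ true) (allFin n)

  degree≡∑ : ∀ v → degree G v ≡ ∑[ u < n ] ⟦ adj G v u ⟧
  degree≡∑ v = trans (length-filter-tabulate (λ u → adj G v u ≟ᴮ true) id)
                     (sum-cong-≗ λ u → does-≟true (adj G v u))
    where
    does-≟true : ∀ b → ⟦ does (b ≟ᴮ true) ⟧ ≡ ⟦ b ⟧
    does-≟true false = refl
    does-≟true true  = refl

  injective-neighbours≤degree : ∀ {m v} (f : Fin m → Fin n) → Injective _≡_ _≡_ f →
    (∀ i → Adj G v (f i)) → m ≤ degree G v
  injective-neighbours≤degree {v = v} f f-inj f-adj =
    injective⇒≤ {f = index ∘ member} (f-inj ∘ index-injective (setoid (Fin n)) (member _) (member _))
    where
    member : ∀ i → f i ∈ neighbours v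
    member i = ∈-filter⁺ (λ u → adj G v u ≟ᴮ true) (∈-allFin (f i)) (f-adj i)

Clique : ∀ {n} → Graph n → ℕ → Set
Clique {n} G m = Σ (Fin m → Fin n) λ W → ∀ {i j} → i ≢ j → Adj G (W i) (W j)

module _ {n d : ℕ} {G : Graph n} (W : Fin (suc d) → Fin n)
         (W-adj : ∀ {i j} → i ≢ j → Adj G (W i) (W j)) where

  adj-W : ∀ i j → adj G (W i) (W j) ≡ not (does (i ≟ j))
  adj-W i j with i ≟ j
  ... | yes refl = adj-irrefl G (W i)
  ... | no  i≢j  = W-adj i≢j

  W-injective : Injective _≡_ _≡_ W
  W-injective {i} {j} Wi≡Wj with i ≟ j
  ... | yes i≡j = i≡j
  ... | no  i≢j = contradiction Wi≡Wj (Adj⇒≢ G (W-adj i≢j))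

  module _ (deg≤ : ∀ v → degree G v ≤ d) where

    neighbour∈clique : ∀ {i y} → Adj G (W i) y → ∃ λ j → W j ≡ y
    neighbour∈clique {i} {y} Wi-y with any? (λ j → W j ≟ y)
    ... | yes y∈W = y∈W
    ... | no  y∉W = contradiction (injective-neighbours≤degree G f f-inj f-adj) (<⇒≱ (s≤s (deg≤ (W i))))
      where
      f : Fin (suc d) → Fin n
      f j with j ≟ i
      ... | yes _ = y
      ... | no  _ = W j

      f-inj : Injective _≡_ _≡_ f
      f-inj {j} {j′} fj≡fj′ with j ≟ i | j′ ≟ i
      ... | yes j≡i | yes j′≡i = trans j≡i (sym j′≡i)
      ... | yes _   | no  _    = contradiction (j′ , sym fj≡fj′) y∉W
      ... | no  _   | yes _    = contradiction (j , fj≡fj′) y∉W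
      ... | no  _   | no  _    = W-injective fj≡fj′

      f-adj : ∀ j → Adj G (W i) (f j)
      f-adj j with j ≟ i
      ... | yes _   = Wi-y
      ... | no  j≢i = W-adj (j≢i ∘ sym)

    clique-spans : Connected G → ∀ v → ∃ λ j → W j ≡ v
    clique-spans conn v = along (conn (W zero) v) (zero , refl)
      where
      along : ∀ {x y} → Star (Adj G) x y → ∃ (λ j → W j ≡ x) → ∃ λ j → W j ≡ y
      along ε             x∈W      = x∈W
      along (x-z ◅ walk) (j , refl) = along walk (neighbour∈clique x-z)

    clique⇒≅complete : Connected G → G ≅ complete (suc d)
    clique⇒≅complete conn =
      mk⤖ {to = position} (position-injective , position-surjective) , adj-preserved
      where
      open ≡-Reasoning
      position : Fin n → Fin (suc d)
      position v = proj₁ (clique-spans conn v)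

      W∘position : ∀ v → W (position v) ≡ v
      W∘position v = proj₂ (clique-spans conn v)

      position-injective : Injective _≡_ _≡_ position
      position-injective {u} {v} eq = trans (sym (W∘position u)) (trans (cong W eq) (W∘position v))

      position-surjective : ∀ j → ∃ λ v → ∀ {u} → u ≡ v → position u ≡ j
      position-surjective j = W j , λ { refl → W-injective (W∘position (W j)) }

      adj-preserved : ∀ u v → adj G u v ≡ adj (complete (suc d)) (position u) (position v)
      adj-preserved u v = begin
        adj G u v                                 ≡⟨ cong₂ (adj G) (W∘position u) (W∘position v) ⟨
        adj G (W (position u)) (W (position v))   ≡⟨ adj-W (position u) (position v) ⟩
        not (does (position u ≟ position v))      ∎

clique₄ : ∀ {n} {G : Graph n} {w x y z} → Adj G w x → Adj G w y → Adj G w z →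
  Adj G x y → Adj G x z → Adj G y z → Clique G 4
clique₄ {n} {G} {w} {x} {y} {z} wx wy wz xy xz yz = W , edge _ _
  where
  W : Fin 4 → Fin n
  W 0F = w
  W 1F = x
  W 2F = y
  W 3F = z

  edge : ∀ i j → i ≢ j → Adj G (W i) (W j)
  edge 0F 1F _ = wx
  edge 0F 2F _ = wy
  edge 0F 3F _ = wz
  edge 1F 2F _ = xy
  edge 1F 3F _ = xz
  edge 2F 3F _ = yz
  edge 1F 0F _ = Adj-sym G wx
  edge 2F 0F _ = Adj-sym G wy
  edge 3F 0F _ = Adj-sym G wz
  edge 2F 1F _ = Adj-sym G xy
  edge 3F 1F _ = Adj-sym G xz
  edge 3F 2F _ = Adj-sym G yz
  edge 0F 0F i≢i = contradiction refl i≢i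
  edge 1F 1F i≢i = contradiction refl i≢i
  edge 2F 2F i≢i = contradiction refl i≢i
  edge 3F 3F i≢i = contradiction refl i≢i

-- Breadth-first ranking

least : (ℕ → Bool) → ℕ → ℕ
least p zero    = 0
least p (suc b) = if p 0 then 0 else suc (least (p ∘ suc) b)

least-holds : ∀ (p : ℕ → Bool) b → T (p b) → T (p (least p b))
least-holds p zero    pb = pb
least-holds p (suc b) pb with p 0 in p0
... | true  = subst T (sym p0) _
... | false = least-holds (p ∘ suc) b pb

least-minimal : ∀ (p : ℕ → Bool) b {m} → m < least p b → ¬ T (p m)
least-minimal p (suc b) {m} m<least with p 0 in p0
least-minimal p (suc b) {zero}  _             | false = subst T p0
least-minimal p (suc b) {suc m} (s≤s m<least) | false = least-minimal (p ∘ suc) b m<least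

record RootedRanking {n} (G : Graph n) (r : Fin n) : Set where
  field
    rank              : Fin n → ℕ
    rank-injective    : Injective _≡_ _≡_ rank
    earlier-neighbour : ∀ v → v ≢ r → ∃ λ u → Adj G v u × rank u < rank v

module BreadthFirst {n} {G : Graph n} (conn : Connected G) (r : Fin n) where

  within : ℕ → Fin n → Bool
  within zero    v = isYes (v ≟ r)
  within (suc m) v = within m v ∨ isYes (any? λ u → T? (adj G v u ∧ within m u))

  within-step : ∀ m {u v} → T (within m u) → Adj G v u → T (within (suc m) v)
  within-step m {u} {v} t vu =
    Equivalence.from (T-∨ {within m v})
      (inj₂ (fromWitness (u , Equivalence.from T-∧ (Equivalence.from T-≡ vu , t))))

  within-back : ∀ m {v} → T (within (suc m) v) → ¬ T (within m v) →
    ∃ λ u → Adj G v u × T (within m u)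
  within-back m t ¬t with Equivalence.to T-∨ t
  ... | inj₁ t′ = contradiction t′ ¬t
  ... | inj₂ w  with toWitness w
  ...   | u , vu∧t with Equivalence.to T-∧ vu∧t
  ...     | vu , tu = u , Equivalence.to T-≡ vu , tu

  walk⇒within : ∀ m {u v} → Star (Adj G) u v → T (within m u) → ∃ λ m′ → T (within m′ v)
  walk⇒within m ε           t = m , t
  walk⇒within m (uw ◅ walk) t = walk⇒within (suc m) walk (within-step m t (Adj-sym G uw))

  reached : ∀ v → ∃ λ m → T (within m v)
  reached v = walk⇒within 0 (conn r v) (fromWitness refl)

  level : Fin n → ℕ
  level v = least (λ m → within m v) (proj₁ (reached v))

  level-within : ∀ v → T (within (level v) v)
  level-within v = least-holds (λ m → within m v) (proj₁ (reached v)) (proj₂ (reached v))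

  level-minimal : ∀ m {v} → T (within m v) → level v ≤ m
  level-minimal m {v} t = ≮⇒≥ λ m<level → least-minimal (λ m → within m v) (proj₁ (reached v)) m<level t

  rank : Fin n → ℕ
  rank v = level v * n + toℕ v

  rank-mono : ∀ {u v} → level u < level v → rank u < rank v
  rank-mono {u} {v} lu<lv = begin-strict
    level u * n + toℕ u  <⟨ +-monoʳ-< (level u * n) (toℕ<n u) ⟩
    level u * n + n      ≡⟨ +-comm (level u * n) n ⟩
    suc (level u) * n    ≤⟨ *-monoˡ-≤ n lu<lv ⟩
    level v * n          ≤⟨ m≤m+n (level v * n) (toℕ v) ⟩
    rank v               ∎
    where open ≤-Reasoning

  rank-injective : Injective _≡_ _≡_ rank
  rank-injective {u} {v} eq with <-cmp (level u) (level v)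
  ... | tri< lu<lv _ _ = contradiction eq (<⇒≢ (rank-mono lu<lv))
  ... | tri> _ _ lv<lu = contradiction (sym eq) (<⇒≢ (rank-mono lv<lu))
  ... | tri≈ _ lu≡lv _ rewrite lu≡lv = toℕ-injective (+-cancelˡ-≡ (level v * n) (toℕ u) (toℕ v) eq)

  earlier-level : ∀ v → v ≢ r → ∃ λ u → Adj G v u × level u < level v
  earlier-level v v≢r with level v in lv | level-within v
  ... | zero  | t = contradiction (toWitness t) v≢r
  ... | suc m | t with within-back m t (λ tm → 1+n≰n (subst (_≤ m) lv (level-minimal m tm)))
  ...   | u , vu , tu = u , vu , s≤s (level-minimal m tu)

  rootedRanking : RootedRanking G r
  rootedRanking = record
    { rank              = rank
    ; rank-injective    = rank-injective
    ; earlier-neighbour = λ v v≢r → let u , vu , lu<lv = earlier-level v v≢r in u , vu , rank-mono lu<lv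
    }

innerSum : ∀ {n} → (Fin n → Fin n → ℕ) → List (Fin n) → ℕ
innerSum e xs = ListAction.sum (map (λ i → ListAction.sum (map (e i) xs)) xs)

-- e counts every edge in at most one direction, so innerSum e xs is at most the number of
-- edges spanned by xs.
module _ {n : ℕ} {G : Graph n} {e : Fin n → Fin n → ℕ}
         (e-diag : ∀ i → e i i ≡ 0) (e-pair : ∀ i j → e i j + e j i ≤ ⟦ adj G i j ⟧) where

  innerSum₂ : ∀ a b → innerSum e (a ∷ b ∷ []) ≡ e a b + e b a
  innerSum₂ a b rewrite e-diag a | e-diag b = reshape (e a b) (e b a)
    where
    reshape : ∀ ab ba → ab + 0 + (ba + 0 + 0) ≡ ab + ba
    reshape = solve-∀

  innerSum₃ : ∀ a b c → innerSum e (a ∷ b ∷ c ∷ []) ≡ (e a b + e b a) + (e a c + e c a) + (e b c + e c b)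
  innerSum₃ a b c rewrite e-diag a | e-diag b | e-diag c =
    reshape (e a b) (e a c) (e b a) (e b c) (e c a) (e c b)
    where
    reshape : ∀ ab ac ba bc ca cb →
      ab + (ac + 0) + (ba + (bc + 0) + (ca + (cb + 0) + 0)) ≡ (ab + ba) + (ac + ca) + (bc + cb)
    reshape = solve-∀

  innerSum<length : ∀ {k} xs → length xs ≤ 3 → All (Adj G k) xs →
    (innerSum e xs < length xs ⊎ xs ≡ []) ⊎ Clique G 4
  innerSum<length []          _ _ = inj₁ (inj₂ refl)
  innerSum<length (a ∷ [])    _ _ rewrite e-diag a = inj₁ (inj₁ (s≤s z≤n))
  innerSum<length (a ∷ b ∷ []) _ _ rewrite innerSum₂ a b =
    inj₁ (inj₁ (s≤s (≤-trans (e-pair a b) (⟦⟧≤1 (adj G a b)))))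
  innerSum<length (a ∷ b ∷ c ∷ []) _ (ka ∷ kb ∷ kc ∷ [])
    rewrite innerSum₃ a b c
    with ⟦⟧-sum₃ (adj G a b) (adj G a c) (adj G b c)
  ... | inj₁ edges<3 = inj₁ (inj₁ (≤-<-trans
          (+-mono-≤ (+-mono-≤ (e-pair a b) (e-pair a c)) (e-pair b c)) edges<3))
  ... | inj₂ (ab , ac , bc) = inj₂ (clique₄ {G = G} ka kb kc (T⇒Adj ab) (T⇒Adj ac) (T⇒Adj bc))
    where
    T⇒Adj : ∀ {u v} → T (adj G u v) → Adj G u v
    T⇒Adj = Equivalence.to T-≡
  innerSum<length (_ ∷ _ ∷ _ ∷ _ ∷ _) (s≤s (s≤s (s≤s ()))) _

-- Back-neighbours and back-triangles

module BackCounts {n : ℕ} (G : Graph n) (ρ : Fin n → ℕ) where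

  isBackNeighbour : Fin n → Fin n → Bool
  isBackNeighbour k u = adj G k u ∧ (ρ u <ᵇ ρ k)

  backDegree : Fin n → ℕ
  backDegree k = ∑[ u < n ] ⟦ isBackNeighbour k u ⟧

  backTriangle : Fin n → Fin n → Fin n → ℕ
  backTriangle k i j = ⟦ isTriangle G i j k ∧ (ρ i <ᵇ ρ j) ∧ (ρ j <ᵇ ρ k) ⟧

  backTriangles : Fin n → ℕ
  backTriangles k = ∑[ i < n ] ∑[ j < n ] backTriangle k i j

  backNeighbours : Fin n → List (Fin n)
  backNeighbours k = filterᵇ (isBackNeighbour k) (allFin n)

  backDegree≡length : ∀ k → backDegree k ≡ length (backNeighbours k)
  backDegree≡length k = sym (length-filter-tabulate (T? ∘ isBackNeighbour k) id)

  backDegree≤degree : ∀ k → backDegree k ≤ degree G k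
  backDegree≤degree k = subst (backDegree k ≤_) (sym (degree≡∑ G k))
    (∑-mono-≤ λ u → ⟦∧⟧≤⟦⟧ˡ (adj G k u) (ρ u <ᵇ ρ k))

  backNeighbours-adjacent : ∀ k → All (Adj G k) (backNeighbours k)
  backNeighbours-adjacent k = All.map (λ t → Equivalence.to T-≡ (proj₁ (Equivalence.to T-∧ t)))
    (all-filter (T? ∘ isBackNeighbour k) (allFin n))

  backTriangle⇒backNeighbours : ∀ {k i j} → T (isTriangle G i j k ∧ (ρ i <ᵇ ρ j) ∧ (ρ j <ᵇ ρ k)) →
    T (isBackNeighbour k i) × T (isBackNeighbour k j)
  backTriangle⇒backNeighbours {k} {i} {j} t
    with tri , i<j∧j<k ← T-∧⁻ (isTriangle G i j k) ((ρ i <ᵇ ρ j) ∧ (ρ j <ᵇ ρ k)) t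
    with _ , jk∧ik ← T-∧⁻ (adj G i j) (adj G j k ∧ adj G i k) tri
    with jk , ik ← T-∧⁻ (adj G j k) (adj G i k) jk∧ik
    with i<j , j<k ← T-∧⁻ (ρ i <ᵇ ρ j) (ρ j <ᵇ ρ k) i<j∧j<k
    = back ik (<-trans (<ᵇ⇒< (ρ i) (ρ j) i<j) (<ᵇ⇒< (ρ j) (ρ k) j<k)) , back jk (<ᵇ⇒< (ρ j) (ρ k) j<k)
    where
    back : ∀ {u} → T (adj G u k) → ρ u < ρ k → T (isBackNeighbour k u)
    back {u} uk u<k = Equivalence.from (T-∧ {adj G k u}) (subst T (adj-sym G u k) uk , <⇒<ᵇ u<k)

  backTriangles≡innerSum : ∀ k → backTriangles k ≡ innerSum (backTriangle k) (backNeighbours k)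
  backTriangles≡innerSum k = begin
    ∑[ i < n ] ∑[ j < n ] backTriangle k i j
      ≡⟨ sum-cong-≗ (λ i → sum-cong-≗ λ j → ⟦⟧-supported _ (isBackNeighbour k i) (isBackNeighbour k j)
           backTriangle⇒backNeighbours) ⟩
    ∑[ i < n ] ∑[ j < n ] (⟦ isBackNeighbour k i ⟧ * (⟦ isBackNeighbour k j ⟧ * backTriangle k i j))
      ≡⟨ sum-cong-≗ (λ i → *-distribˡ-sum ⟦ isBackNeighbour k i ⟧
           λ j → ⟦ isBackNeighbour k j ⟧ * backTriangle k i j) ⟨
    ∑[ i < n ] (⟦ isBackNeighbour k i ⟧ * ∑[ j < n ] (⟦ isBackNeighbour k j ⟧ * backTriangle k i j))
      ≡⟨ sum-cong-≗ (λ i → cong (⟦ isBackNeighbour k i ⟧ *_)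
           (sum-map-filter-tabulate B? (backTriangle k i) id)) ⟨
    ∑[ i < n ] (⟦ isBackNeighbour k i ⟧ * ListAction.sum (map (backTriangle k i) (backNeighbours k)))
      ≡⟨ sum-map-filter-tabulate B? (λ i → ListAction.sum (map (backTriangle k i) (backNeighbours k))) id ⟨
    innerSum (backTriangle k) (backNeighbours k) ∎
    where
    open ≡-Reasoning
    B? : Decidable (T ∘ isBackNeighbour k)
    B? = T? ∘ isBackNeighbour k

  backTriangle-diag : ∀ k i → backTriangle k i i ≡ 0
  backTriangle-diag k i rewrite adj-irrefl G i = refl

  backTriangle-pair : ∀ k i j → backTriangle k i j + backTriangle k j i ≤ ⟦ adj G i j ⟧
  backTriangle-pair k i j rewrite adj-sym G j i with adj G i j
  ... | false = z≤n
  ... | true  = ≤-trans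
    (+-mono-≤ (⟦∧∧⟧≤⟦⟧₂ (adj G j k ∧ adj G i k) (ρ i <ᵇ ρ j) (ρ j <ᵇ ρ k))
              (⟦∧∧⟧≤⟦⟧₂ (adj G i k ∧ adj G j k) (ρ j <ᵇ ρ i) (ρ i <ᵇ ρ k)))
    (⟦<ᵇ⟧-asym (ρ i) (ρ j))

  FewBackTriangles : Fin n → Set
  FewBackTriangles k = backTriangles k < backDegree k ⊎ backDegree k ≡ 0 × backTriangles k ≡ 0

  fewBackTriangles-or-K₄ : ∀ k → degree G k ≤ 3 → FewBackTriangles k ⊎ Clique G 4
  fewBackTriangles-or-K₄ k deg≤3
    rewrite backTriangles≡innerSum k | backDegree≡length k
    with innerSum<length {G = G} (backTriangle-diag k) (backTriangle-pair k) (backNeighbours k)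
           (≤-trans (subst (_≤ degree G k) (backDegree≡length k) (backDegree≤degree k)) deg≤3)
           (backNeighbours-adjacent k)
  ... | inj₁ (inj₁ lt) = inj₁ (inj₁ lt)
  ... | inj₁ (inj₂ B≡[]) rewrite B≡[] = inj₁ (inj₂ (refl , refl))
  ... | inj₂ K₄ = inj₂ K₄

  ∑backTriangles≡triangles : Injective _≡_ _≡_ ρ → ∑[ k < n ] backTriangles k ≡ triangles G
  ∑backTriangles≡triangles ρ-inj = begin
    ∑[ k < n ] backTriangles k
      ≡⟨ ∑³-rotate (λ i j k → backTriangle k i j) ⟩
    sortedCount (isTriangle G) ρ
      ≡⟨ sortedCount-ranking-invariant (isTriangle-swap₂₃ G) (isTriangle-swap₁₂ G) (isTriangle⇒≢ G)
           ρ-inj toℕ-injective ⟩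
    sortedCount (isTriangle G) toℕ
      ≡⟨ triangles≡sortedCount G ⟨
    triangles G ∎
    where open ≡-Reasoning

  handshake : Injective _≡_ _≡_ ρ →
    ∑[ v < n ] degree G v ≡ ∑[ k < n ] backDegree k + ∑[ k < n ] backDegree k
  handshake ρ-inj = begin
    ∑[ v < n ] degree G v
      ≡⟨ sum-cong-≗ (degree≡∑ G) ⟩
    ∑[ v < n ] ∑[ u < n ] ⟦ adj G v u ⟧
      ≡⟨ sum-cong-≗ (λ v → sum-cong-≗ (split v)) ⟩
    ∑[ v < n ] ∑[ u < n ] (⟦ isBackNeighbour v u ⟧ + ⟦ isBackNeighbour u v ⟧)
      ≡⟨ sum-cong-≗ (λ v → ∑-distrib-+ (λ u → ⟦ isBackNeighbour v u ⟧) (λ u → ⟦ isBackNeighbour u v ⟧)) ⟩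
    ∑[ v < n ] (backDegree v + ∑[ u < n ] ⟦ isBackNeighbour u v ⟧)
      ≡⟨ ∑-distrib-+ backDegree (λ v → ∑[ u < n ] ⟦ isBackNeighbour u v ⟧) ⟩
    ∑[ k < n ] backDegree k + ∑[ v < n ] ∑[ u < n ] ⟦ isBackNeighbour u v ⟧
      ≡⟨ cong (∑[ k < n ] backDegree k +_) (∑-comm (λ v u → ⟦ isBackNeighbour u v ⟧)) ⟩
    ∑[ k < n ] backDegree k + ∑[ k < n ] backDegree k ∎
    where
    open ≡-Reasoning
    split : ∀ v u → ⟦ adj G v u ⟧ ≡ ⟦ isBackNeighbour v u ⟧ + ⟦ isBackNeighbour u v ⟧
    split v u rewrite adj-sym G u v with adj G v u in vu
    ... | false = refl
    ... | true rewrite <ᵇ-flip {ρ u} {ρ v} (λ ρu≡ρv → Adj⇒≢ G vu (sym (ρ-inj ρu≡ρv))) =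
      sym (⟦⟧+⟦not⟧ (ρ u <ᵇ ρ v))

module _ {n : ℕ} {G : Graph n} {r : Fin n} (R : RootedRanking G r) where
  open RootedRanking R
  open BackCounts G rank

  backDegree-positive : ∀ {k} → k ≢ r → 0 < backDegree k
  backDegree-positive {k} k≢r with earlier-neighbour k k≢r
  ... | u , ku , u<k = subst (_≤ backDegree k) back-u (term≤∑ (λ u → ⟦ isBackNeighbour k u ⟧) u)
    where
    back-u : ⟦ isBackNeighbour k u ⟧ ≡ 1
    back-u rewrite ku | <ᵇ-true u<k = refl

  triangles+n≤∑backDegree+1 : (∀ k → FewBackTriangles k) → triangles G + n ≤ ∑[ k < n ] backDegree k + 1
  triangles+n≤∑backDegree+1 local = begin
    triangles G + n
      ≡⟨ cong₂ _+_ (∑backTriangles≡triangles rank-injective) (trans (∑-const n 1) (*-identityʳ n)) ⟨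
    ∑[ k < n ] backTriangles k + ∑[ k < n ] 1
      ≡⟨ ∑-distrib-+ backTriangles (λ _ → 1) ⟨
    ∑[ k < n ] (backTriangles k + 1)
      ≤⟨ ∑-mono-≤ per-vertex ⟩
    ∑[ k < n ] (backDegree k + ⟦ does (k ≟ r) ⟧)
      ≡⟨ ∑-distrib-+ backDegree (λ k → ⟦ does (k ≟ r) ⟧) ⟩
    ∑[ k < n ] backDegree k + ∑[ k < n ] ⟦ does (k ≟ r) ⟧
      ≡⟨ cong (∑[ k < n ] backDegree k +_) (∑-indicator r) ⟩
    ∑[ k < n ] backDegree k + 1 ∎
    where
    open ≤-Reasoning
    per-vertex : ∀ k → backTriangles k + 1 ≤ backDegree k + ⟦ does (k ≟ r) ⟧
    per-vertex k with k ≟ r | local k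
    ... | yes _   | inj₁ bt<bd           = +-monoˡ-≤ 1 (<⇒≤ bt<bd)
    ... | yes _   | inj₂ (bd≡0 , bt≡0)   = +-monoˡ-≤ 1 (≤-reflexive (trans bt≡0 (sym bd≡0)))
    ... | no  _   | inj₁ bt<bd           =
      subst₂ _≤_ (+-comm 1 (backTriangles k)) (sym (+-identityʳ (backDegree k))) bt<bd
    ... | no  k≢r | inj₂ (bd≡0 , _)      = contradiction bd≡0 (>⇒≢ (backDegree-positive k≢r))

degree-sum≤ : ∀ {n d} (G : Graph n) → (∀ v → degree G v ≤ suc d) →
  ∑[ v < n ] degree G v ≤ n * d + numDeg G (suc d)
degree-sum≤ {n} {d} G deg≤ = begin
  ∑[ v < n ] degree G v
    ≤⟨ ∑-mono-≤ (λ v → below (deg≤ v)) ⟩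
  ∑[ v < n ] (d + ⟦ does (degree G v ℕ.≟ suc d) ⟧)
    ≡⟨ ∑-distrib-+ (λ _ → d) (λ v → ⟦ does (degree G v ℕ.≟ suc d) ⟧) ⟩
  ∑[ v < n ] d + ∑[ v < n ] ⟦ does (degree G v ℕ.≟ suc d) ⟧
    ≡⟨ cong₂ _+_ (sym (∑-const n d)) (length-filter-tabulate (λ v → degree G v ℕ.≟ suc d) id) ⟨
  n * d + numDeg G (suc d) ∎
  where
  open ≤-Reasoning
  below : ∀ {x} → x ≤ suc d → x ≤ d + ⟦ does (x ℕ.≟ suc d) ⟧
  below {x} x≤1+d with x ℕ.≟ suc d
  ... | yes refl rewrite dec-true (suc d ℕ.≟ suc d) refl = ≤-reflexive (+-comm 1 d)
  ... | no  x≢1+d rewrite dec-false (x ℕ.≟ suc d) x≢1+d =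
    ≤-trans (≤-pred (≤∧≢⇒< x≤1+d x≢1+d)) (m≤m+n d 0)

triangle-arithmetic : ∀ {t n e n₃} → 4 ≤ t → t + n ≤ e + 1 → e + e ≤ n * 2 + n₃ → t + 2 ≤ n₃
triangle-arithmetic {t} {n} {e} {n₃} 4≤t t+n≤e+1 e+e≤ = +-cancelʳ-≤ (2 + n * 2) (t + 2) n₃ (begin
  t + 2 + (2 + n * 2)    ≡⟨ lhs t n ⟩
  4 + t + n * 2          ≤⟨ +-monoˡ-≤ (n * 2) (+-monoˡ-≤ t 4≤t) ⟩
  t + t + n * 2          ≡⟨ mid t n ⟩
  (t + n) + (t + n)      ≤⟨ +-mono-≤ t+n≤e+1 t+n≤e+1 ⟩
  (e + 1) + (e + 1)      ≡⟨ rhs e ⟩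
  e + e + 2              ≤⟨ +-monoˡ-≤ 2 e+e≤ ⟩
  n * 2 + n₃ + 2         ≡⟨ end n n₃ ⟩
  n₃ + (2 + n * 2)       ∎)
  where
  open ≤-Reasoning
  lhs : ∀ t n → t + 2 + (2 + n * 2) ≡ 4 + t + n * 2
  lhs = solve-∀
  mid : ∀ t n → t + t + n * 2 ≡ (t + n) + (t + n)
  mid = solve-∀
  rhs : ∀ e → (e + 1) + (e + 1) ≡ e + e + 2
  rhs = solve-∀
  end : ∀ n n₃ → n * 2 + n₃ + 2 ≡ n₃ + (2 + n * 2)
  end = solve-∀

corollary4 : ∀ {n} (H : Graph n) → Connected H → MaxDegree H 3 → 4 ≤ triangles H →
    (H ≅ complete 4) ⊎ (triangles H + 2 ≤ numDeg H 3)
corollary4 {n} H conn (deg≤3 , r , _) 4≤t =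
  [ inj₂ ∘ many-cubic , inj₁ ∘ K₄⇒≅complete ]′ (∀-or λ k → fewBackTriangles-or-K₄ k (deg≤3 k))
  where
  R : RootedRanking H r
  R = BreadthFirst.rootedRanking conn r
  open RootedRanking R using (rank; rank-injective)
  open BackCounts H rank

  K₄⇒≅complete : Clique H 4 → H ≅ complete 4
  K₄⇒≅complete (W , W-adj) = clique⇒≅complete {G = H} W W-adj deg≤3 conn

  many-cubic : (∀ k → FewBackTriangles k) → triangles H + 2 ≤ numDeg H 3
  many-cubic local = triangle-arithmetic 4≤t (triangles+n≤∑backDegree+1 R local) (begin
    ∑[ k < n ] backDegree k + ∑[ k < n ] backDegree k  ≡⟨ handshake rank-injective ⟨
    ∑[ v < n ] degree H v                               ≤⟨ degree-sum≤ H deg≤3 ⟩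
    n * 2 + numDeg H 3                                  ∎)
    where open ≤-Reasoning
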